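{- Let $T$ be a left-linear infinitary term rewriting system and $\psi$ a convergent infinitary multistep over $T$. Then there exist $\chi$ and $\phi$ such that $\psi\approx_E\chi\cdot\phi$, $\chi$ is a finite stepwise-or-null proof term every component of which has depth $0$ (i.e. $depth(\chi[i])=0$ for all $i<\#(\chi)$), and $\phi$ is a convergent infinitary multistep with $mind(\phi)>0$.
   Context: Terms over a finite signature $\Sigma$ and countable variable set: finite or infinite trees (nonempty prefix-closed position sets, arity-respecting labels); $Ter^\infty(\Sigma)$; $C[t_1..t_n]$ fills variable occurrences; $d(t,u)=2^{ -k}$ with $k$ least depth of difference; limits w.r.t. $d$. TRS: left-linear rules $\mu:l\to r$; $l=l[x_1..x_n]$, $r=r[x_1..x_n]$; rule symbol $\mu$ of arity $n$. Infinitary multisteps: closed finite/infinite terms over $\Sigma$ and rule symbols; $src(\psi)$ normal form under $\mu(\vec x)\to l[\vec x]$; $\psi$ convergent iff it reaches a rule-symbol-free normal form under $\mu(\vec x)\to r[\vec x]$ via a strongly convergent reduction ($tgt(\psi)$ that form); $mind(\psi)$ minimal depth of a rule symbol occurrence ($\omega$ if none). Proof terms: least set of closed terms over $\Sigma$, rule symbols, binary $\cdot$, with $src$, partial $tgt$, convergence, $mind$: multisteps; infinite concatenations $\cdot_{i<\omega}\psi_i$ of convergent $\psi_i$ with $tgt\psi_i=src\psi_{i+1}$ ($src=src\psi_0$, $tgt=\lim tgt\psi_i$, $mind=\min$, convergent iff $mind\psi_j\to\omega$); $\psi_1\cdot\psi_2$ for convergent $\psi_1$, $tgt\psi_1=src\psi_2$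 ($src=src\psi_1$, $tgt=tgt\psi_2$, $mind=\min$, convergent iff $\psi_2$ is); $f(\vec\psi)$ and $\mu(\vec\psi)$ for proof terms $\psi_i$ not all multisteps ($f$: componentwise, $mind=1+\min$; $\mu$: $src=l[src\psi_i]$, $tgt=r[tgt\psi_i]$, $mind=0$). $\approx_E$: least relation on proof terms containing all instances (both sides proof terms) of $src(\psi)\cdot\psi=\psi$; $\psi\cdot tgt(\psi)=\psi$ ($\psi$ convergent); $\psi\cdot(\phi\cdot\chi)=(\psi\cdot\phi)\cdot\chi$; $f(\vec\psi)\cdot f(\vec\phi)=f(\psi_1\cdot\phi_1,..)$; $\cdot_i f(\psi^1_i,..)=f(\cdot_i\psi^1_i,..)$; $\mu(\vec\psi)=\mu(src\psi_1,..)\cdot r[\vec\psi]$; $\mu(\vec\psi)=l[\vec\psi]\cdot\mu(tgt\psi_1,..)$ (all $\psi_i$ convergent); closed under reflexivity, symmetry, transitivity and congruence for function symbols, rule symbols, binary and infinite concatenation. A one-step is a multistep with exactly one rule symbol occurrence; its depth is the length of the position of that occurrence. Stepwise proof terms: least set containing one-steps, closed under binary and infinite concatenation; stepwise-or-null: stepwise or in $Ter^\infty(\Sigma)$. $\#(\psi)$: $0$ on $Ter^\infty(\Sigma)$, $1$ on one-steps, additive (infinite sums as suprema). Finite: $\#(\chi)<\omega$. Components $\chi[i]$: one-step $\chi[0]=\chi$; for $\chi_1\cdot\chi_2$, $\chi_1[i]$ if $i<\#\chi_1$, else $\chi_2[i-\#\chi_1]$. -}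

module Defs where

open import Data.Nat using (ℕ; zero; suc; _+_; _≤_; _<_; _<?_; _≡ᵇ_)
open import Data.Fin using (Fin; toℕ; fromℕ<) renaming (zero to fzero; suc to fsuc; _≟_ to _≟F_)
open import Data.Bool using (Bool; true; false; _∧_; if_then_else_)
open import Data.List using (List; []; _∷_; _++_; length)
open import Data.Maybe using (Maybe; just; nothing; maybe′)
open import Data.Sum using (_⊎_; inj₁; inj₂; [_,_])
open import Data.Product using (Σ; ∃; _×_; _,_)
open import Data.Empty using (⊥)
open import Data.Unit using (⊤)
open import Relation.Nullary using (¬_; yes; no)
open import Relation.Binary.PropositionalEquality using (_≡_)

record Signature : Set where
  field
    nsym : ℕ
    ar   : Fin nsym → ℕ

sumFin : (n : ℕ) → (Fin n → ℕ) → ℕ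
sumFin zero    f = 0
sumFin (suc n) f = f fzero + sumFin n (λ i → f (fsuc i))

allFin : (n : ℕ) → (Fin n → Bool) → Bool
allFin zero    f = true
allFin (suc n) f = f fzero ∧ allFin n (λ i → f (fsuc i))

data FTerm (S : Signature) (n : ℕ) : Set where
  var : Fin n → FTerm S n
  app : (f : Fin (Signature.nsym S)) → (Fin (Signature.ar S f) → FTerm S n) → FTerm S n

occ : {S : Signature} {n : ℕ} → Fin n → FTerm S n → ℕ
occ x (var y) with x ≟F y
... | yes _ = 1
... | no  _ = 0
occ {S} x (app f cs) = sumFin (Signature.ar S f) (λ i → occ x (cs i))

isVar : {S : Signature} {n : ℕ} → FTerm S n → Set
isVar (var _)   = ⊤
isVar (app _ _) = ⊥

record TRS (S : Signature) : Set₁ where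
  field
    Rule       : Set
    rar        : Rule → ℕ
    lhs        : (μ : Rule) → FTerm S (rar μ)
    rhs        : (μ : Rule) → FTerm S (rar μ)
    lhs-nonvar : (μ : Rule) → ¬ isVar (lhs μ)
    lhs-linear : (μ : Rule) (x : Fin (rar μ)) → occ x (lhs μ) ≡ 1

strip : List ℕ → List ℕ → Maybe (List ℕ)
strip []      q       = just q
strip (x ∷ p) []      = nothing
strip (x ∷ p) (y ∷ q) = if x ≡ᵇ y then strip p q else nothing

module Theory (S : Signature) (T : TRS S) where
  open Signature S
  open TRS T

  Lab : Set
  Lab = Fin nsym ⊎ Rule

  arity : Lab → ℕ
  arity = [ ar , rar ]

  -- (raw) possibly infinite trees, given by their labelling of positions
  -- (positions = lists of child indices from the root; depth = length)
  RTree : Set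
  RTree = List ℕ → Maybe Lab

  _≈ₜ_ : RTree → RTree → Set
  t ≈ₜ u = ∀ p → t p ≡ u p

  record IsTree (t : RTree) : Set where
    field
      root     : ¬ (t [] ≡ nothing)
      child⇒   : ∀ p i → ¬ (t (p ++ i ∷ []) ≡ nothing) → Σ Lab λ l → t p ≡ just l × i < arity l
      ⇒child   : ∀ p i l → t p ≡ just l → i < arity l → ¬ (t (p ++ i ∷ []) ≡ nothing)

  -- no rule symbol occurs (i.e. a closed term of Ter^∞(Σ))
  NoRule : RTree → Set
  NoRule t = ∀ p μ → ¬ (t p ≡ just (inj₂ μ))

  node : (l : Lab) → (Fin (arity l) → RTree) → RTree
  node l ts []      = just l
  node l ts (i ∷ p) with i <? arity l
  ... | yes h = ts (fromℕ< h) p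
  ... | no  _ = nothing

  substLab : {n : ℕ} → FTerm S n → (Fin n → RTree) → RTree
  substLab (var x)    σ p       = σ x p
  substLab (app f cs) σ []      = just (inj₁ f)
  substLab (app f cs) σ (i ∷ p) with i <? ar f
  ... | yes h = substLab (cs (fromℕ< h)) σ p
  ... | no  _ = nothing

  -- replace the subtree at position p of u by s
  graft : RTree → List ℕ → RTree → RTree
  graft u p s q = maybe′ s (u q) (strip p q)

  -- limits w.r.t. d: eventual agreement up to every depth
  Lim : (ℕ → RTree) → RTree → Set
  Lim ss t = ∀ k → Σ ℕ λ N → ∀ i → N ≤ i → ∀ p → length p ≤ k → ss i p ≡ t p

  -- one step at position p of the system  μ(x_1..x_n) → ρ μ [x_1..x_n]
  Step : ((μ : Rule) → FTerm S (rar μ)) → RTree → List ℕ → RTree → Set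
  Step ρ u p t = Σ Rule λ μ → u p ≡ just (inj₂ μ) ×
     (∀ q → t q ≡ graft u p (substLab (ρ μ) (λ j q′ → u (p ++ toℕ j ∷ q′))) q)

  -- strongly convergent reductions (of countable ordinal length), all of
  -- whose steps have depth ≥ k.  A reduction of limit length is the
  -- ω-concatenation of the segments between a cofinal sequence of ordinals;
  -- strong convergence = the minimal step depth of the segments tends to ω,
  -- and the term at the limit is the metric limit.
  data SCR (ρ : (μ : Rule) → FTerm S (rar μ)) : ℕ → RTree → RTree → Set where
    nil  : ∀ {k s t} → s ≈ₜ t → SCR ρ k s t
    snoc : ∀ {k s u t} → SCR ρ k s u → (p : List ℕ) → k ≤ length p →
           Step ρ u p t → SCR ρ k s t
    lim  : ∀ {k s t} (ss : ℕ → RTree) (g : ℕ → ℕ) → s ≈ₜ ss 0 →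
           (∀ i → SCR ρ (g i) (ss i) (ss (suc i))) →
           (∀ i → k ≤ g i) →
           (∀ m → Σ ℕ λ N → ∀ i → N ≤ i → m ≤ g i) →
           Lim ss t → SCR ρ k s t

  data PT : Set where
    ms   : RTree → PT
    _∙_  : PT → PT → PT
    icat : (ℕ → PT) → PT
    fn   : (f : Fin nsym) → (Fin (ar f) → PT) → PT
    rl   : (μ : Rule) → (Fin (rar μ) → PT) → PT

  isMSb : PT → Bool
  isMSb (ms _) = true
  isMSb _      = false

  IsMS : PT → Set
  IsMS ψ = isMSb ψ ≡ true

  getT : PT → RTree
  getT (ms t) = t
  getT _      = λ _ → nothing

  smartFn : (f : Fin nsym) → (Fin (ar f) → PT) → PT
  smartFn f ψs = if allFin (ar f) (λ i → isMSb (ψs i))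
                 then ms (node (inj₁ f) (λ i → getT (ψs i))) else fn f ψs

  smartRl : (μ : Rule) → (Fin (rar μ) → PT) → PT
  smartRl μ ψs = if allFin (rar μ) (λ i → isMSb (ψs i))
                 then ms (node (inj₂ μ) (λ i → getT (ψs i))) else rl μ ψs

  substPT : {n : ℕ} → FTerm S n → (Fin n → PT) → PT
  substPT (var x)    ψs = ψs x
  substPT (app f cs) ψs = smartFn f (λ i → substPT (cs i) ψs)

  MindGe : PT → ℕ → Set
  MindGe ψ          zero    = ⊤
  MindGe (ms t)     (suc k) = ∀ p μ → t p ≡ just (inj₂ μ) → suc k ≤ length p
  MindGe (a ∙ b)    (suc k) = MindGe a (suc k) × MindGe b (suc k)
  MindGe (icat ψs)  (suc k) = ∀ i → MindGe (ψs i) (suc k)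
  MindGe (fn f ψs)  (suc k) = ∀ i → MindGe (ψs i) k
  MindGe (rl μ ψs)  (suc k) = ⊥

  -- src ψ = s   (relational; s is determined up to ≈ₜ)
  Src : PT → RTree → Set
  Src (ms t)    s = NoRule s × SCR lhs 0 t s
  Src (a ∙ b)   s = Src a s
  Src (icat ψs) s = Src (ψs 0) s
  Src (fn f ψs) s = Σ (Fin (ar f) → RTree) λ ss →
                     (∀ i → Src (ψs i) (ss i)) × s ≈ₜ node (inj₁ f) ss
  Src (rl μ ψs) s = Σ (Fin (rar μ) → RTree) λ ss →
                     (∀ i → Src (ψs i) (ss i)) × s ≈ₜ substLab (lhs μ) ss

  -- tgt ψ = t   (partial, relational)
  Tgt : PT → RTree → Set
  Tgt (ms t)    s = NoRule s × SCR rhs 0 t s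
  Tgt (a ∙ b)   s = Tgt b s
  Tgt (icat ψs) s = Σ (ℕ → RTree) λ ts → (∀ i → Tgt (ψs i) (ts i)) × Lim ts s
  Tgt (fn f ψs) s = Σ (Fin (ar f) → RTree) λ ss →
                     (∀ i → Tgt (ψs i) (ss i)) × s ≈ₜ node (inj₁ f) ss
  Tgt (rl μ ψs) s = Σ (Fin (rar μ) → RTree) λ ss →
                     (∀ i → Tgt (ψs i) (ss i)) × s ≈ₜ substLab (rhs μ) ss

  Conv : PT → Set
  Conv (ms t)    = Σ RTree λ s → NoRule s × SCR rhs 0 t s
  Conv (a ∙ b)   = Conv b
  Conv (icat ψs) = ∀ m → Σ ℕ λ N → ∀ j → N ≤ j → MindGe (ψs j) m
  Conv (fn f ψs) = ∀ i → Conv (ψs i)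
  Conv (rl μ ψs) = ∀ i → Conv (ψs i)

  data IsPT : PT → Set where
    ms   : ∀ {t} → IsTree t → IsPT (ms t)
    cat  : ∀ {a b} → IsPT a → IsPT b → Conv a →
           (Σ RTree λ u → Tgt a u × Src b u) → IsPT (a ∙ b)
    icat : ∀ {ψs} → (∀ i → IsPT (ψs i)) → (∀ i → Conv (ψs i)) →
           (∀ i → Σ RTree λ u → Tgt (ψs i) u × Src (ψs (suc i)) u) →
           IsPT (icat ψs)
    fn   : ∀ {f ψs} → (∀ i → IsPT (ψs i)) → ¬ (∀ i → IsMS (ψs i)) → IsPT (fn f ψs)
    rl   : ∀ {μ ψs} → (∀ i → IsPT (ψs i)) → ¬ (∀ i → IsMS (ψs i)) → IsPT (rl μ ψs)

  infix 4 _≈E_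
  data _≈E_ : PT → PT → Set where
    tree-eq : ∀ {t u} → IsTree t → t ≈ₜ u → ms t ≈E ms u
    src-id  : ∀ {ψ s} → Src ψ s → IsPT ψ → IsPT (ms s ∙ ψ) → ms s ∙ ψ ≈E ψ
    tgt-id  : ∀ {ψ t} → Conv ψ → Tgt ψ t → IsPT ψ → IsPT (ψ ∙ ms t) → ψ ∙ ms t ≈E ψ
    assoc   : ∀ {ψ φ χ} → IsPT (ψ ∙ (φ ∙ χ)) → IsPT ((ψ ∙ φ) ∙ χ) →
              ψ ∙ (φ ∙ χ) ≈E (ψ ∙ φ) ∙ χ
    fn-cat  : ∀ {f ψs φs} → IsPT (smartFn f ψs ∙ smartFn f φs) →
              IsPT (smartFn f (λ i → ψs i ∙ φs i)) →
              smartFn f ψs ∙ smartFn f φs ≈E smartFn f (λ i → ψs i ∙ φs i)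
    fn-icat : ∀ {f} {ψ : ℕ → Fin (ar f) → PT} →
              IsPT (icat (λ i → smartFn f (ψ i))) →
              IsPT (smartFn f (λ j → icat (λ i → ψ i j))) →
              icat (λ i → smartFn f (ψ i)) ≈E smartFn f (λ j → icat (λ i → ψ i j))
    rl-out  : ∀ {μ ψs} (ss : Fin (rar μ) → RTree) → (∀ i → Src (ψs i) (ss i)) →
              IsPT (smartRl μ ψs) →
              IsPT (smartRl μ (λ i → ms (ss i)) ∙ substPT (rhs μ) ψs) →
              smartRl μ ψs ≈E smartRl μ (λ i → ms (ss i)) ∙ substPT (rhs μ) ψs
    rl-in   : ∀ {μ ψs} (ts : Fin (rar μ) → RTree) → (∀ i → Conv (ψs i)) →
              (∀ i → Tgt (ψs i) (ts i)) →
              IsPT (smartRl μ ψs) →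
              IsPT (substPT (lhs μ) ψs ∙ smartRl μ (λ i → ms (ts i))) →
              smartRl μ ψs ≈E substPT (lhs μ) ψs ∙ smartRl μ (λ i → ms (ts i))
    refl    : ∀ {ψ} → IsPT ψ → ψ ≈E ψ
    sym     : ∀ {ψ φ} → ψ ≈E φ → φ ≈E ψ
    trans   : ∀ {ψ φ χ} → ψ ≈E φ → φ ≈E χ → ψ ≈E χ
    cong-fn : ∀ {f ψs φs} → (∀ i → ψs i ≈E φs i) → smartFn f ψs ≈E smartFn f φs
    cong-rl : ∀ {μ ψs φs} → (∀ i → ψs i ≈E φs i) → smartRl μ ψs ≈E smartRl μ φs
    cong-cat : ∀ {a b a′ b′} → a ≈E a′ → b ≈E b′ → IsPT (a ∙ b) → IsPT (a′ ∙ b′) →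
               a ∙ b ≈E a′ ∙ b′
    cong-icat : ∀ {ψs φs} → (∀ i → ψs i ≈E φs i) → IsPT (icat ψs) → IsPT (icat φs) →
                icat ψs ≈E icat φs

  OneStepAt : RTree → List ℕ → Set
  OneStepAt t p = IsTree t × (Σ Rule λ μ → t p ≡ just (inj₂ μ)) ×
                  (∀ q μ → t q ≡ just (inj₂ μ) → q ≡ p)

  Depth : PT → ℕ → Set
  Depth (ms t) d = Σ (List ℕ) λ p → OneStepAt t p × length p ≡ d
  Depth _      d = ⊥

  data Stepwise : PT → Set where
    one  : ∀ {t p} → OneStepAt t p → Stepwise (ms t)
    cat  : ∀ {a b} → Stepwise a → Stepwise b → IsPT (a ∙ b) → Stepwise (a ∙ b)
    icat : ∀ {ψs} → (∀ i → Stepwise (ψs i)) → IsPT (icat ψs) → Stepwise (icat ψs)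

  StepwiseOrNull : PT → Set
  StepwiseOrNull χ = Stepwise χ ⊎ (Σ RTree λ t → χ ≡ ms t × IsTree t × NoRule t)

  sumBelow : ℕ → (ℕ → ℕ) → ℕ
  sumBelow zero    c = 0
  sumBelow (suc n) c = sumBelow n c + c n

  -- #(χ) = n  (finite values; infinite sums as suprema of partial sums)
  data Count : PT → ℕ → Set where
    null : ∀ {t} → NoRule t → Count (ms t) 0
    one  : ∀ {t p} → OneStepAt t p → Count (ms t) 1
    cat  : ∀ {a b m n} → Count a m → Count b n → Count (a ∙ b) (m + n)
    icat : ∀ {ψs} (c : ℕ → ℕ) → (∀ i → Count (ψs i) (c i)) →
           (N : ℕ) → (∀ i → N ≤ i → c i ≡ 0) → Count (icat ψs) (sumBelow N c)

  data Comp : PT → ℕ → PT → Set where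
    one  : ∀ {t p} → OneStepAt t p → Comp (ms t) 0 (ms t)
    catL : ∀ {a b m i c} → Count a m → i < m → Comp a i c → Comp (a ∙ b) i c
    catR : ∀ {a b m j c} → Count a m → Comp b j c → Comp (a ∙ b) (m + j) c

{-# OPTIONS --safe #-}
module Submission where

-- Write ψ = ms t. If t has no rule symbol at its root, then ψ ≈E src ψ · ψ. Otherwise t = μ(t⃗), and
-- the rule μ(ψ⃗) = μ(src ψ⃗) · r[ψ⃗] of ≈E splits off the root one-step μ(src t⃗). If r is not a
-- variable, r[t⃗] has a function symbol at its root, so its mind is positive; if r = xᵢ, then
-- r[t⃗] = tᵢ and we continue with tᵢ. This chain of collapsing root redexes is finite because ψ
-- converges: the chain is empty for the rule-free target of ψ, stays finite backwards along every
-- rewrite step, and at a limit depends only on a finite prefix of the term. Convergence of r[t⃗]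
-- follows by projecting the reduction of t onto the arguments and the variable occurrences of r.

open import Defs
open import Data.Nat using (ℕ; zero; suc; _+_; _∸_; _≤_; _<_; _<?_; _≡ᵇ_; z≤n; s≤s; s≤s⁻¹; pred; _≟_)
open import Data.Nat.Properties
  using (≤-trans; ≤-refl; <-irrelevant; n≤1+n; <-≤-trans; m≤m+n; m≤n+m; m≤n⇒m<n∨m≡n; <⇒≢; ≮⇒≥; ≤⇒≯; pred-mono-≤; ≡ᵇ⇒≡; ≡⇒≡ᵇ; m+[n∸m]≡n; +-comm; +-cancelˡ-<)
open import Data.Fin using (Fin; toℕ; fromℕ<) renaming (zero to fzero; suc to fsuc; _≟_ to _≟F_)
open import Data.Fin.Properties using (toℕ-fromℕ<; fromℕ<-toℕ; toℕ<n; any?)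
open import Data.Bool using (Bool; true; false)
open import Data.Bool.Properties using (T-≡)
open import Data.List using (List; []; _∷_; _++_; length)
open import Data.List.Properties using (++-assoc; ++-identityʳ; length-++)
open import Data.Maybe using (Maybe; just; nothing)
open import Data.Maybe.Properties using (just-injective)
open import Data.Sum using (_⊎_; inj₁; inj₂)
open import Data.Sum.Properties using (inj₂-injective)
open import Data.Product using (Σ; _×_; _,_; proj₁; proj₂)
open import Data.Empty using (⊥-elim)
open import Data.Unit using (tt)
open import Function.Bundles using (Equivalence)
open import Relation.Nullary using (¬_; yes; no; Dec)
open import Relation.Binary.PropositionalEquality using (_≡_; _≢_; refl; sym; trans; cong; subst; subst₂; cong₂)

≡ᵇ-refl : ∀ n → (n ≡ᵇ n) ≡ true
≡ᵇ-refl n = Equivalence.to T-≡ (≡⇒≡ᵇ n n refl)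

≢⇒≡ᵇ-false : ∀ {m n} → m ≢ n → (m ≡ᵇ n) ≡ false
≢⇒≡ᵇ-false {m} {n} m≢n with m ≡ᵇ n in eq
... | true  = ⊥-elim (m≢n (≡ᵇ⇒≡ m n (Equivalence.from T-≡ eq)))
... | false = refl

allFin-true : ∀ n (f : Fin n → Bool) → (∀ i → f i ≡ true) → allFin n f ≡ true
allFin-true zero    f h = refl
allFin-true (suc n) f h rewrite h fzero = allFin-true n (λ i → f (fsuc i)) (λ i → h (fsuc i))

nothing≢just : ∀ {A : Set} {a : A} → nothing ≢ just a
nothing≢just ()

module Factorisation (S : Signature) (T : TRS S) where
  open Signature S
  open TRS T
  open Theory S T renaming (refl to ≈E-refl; sym to ≈E-sym; trans to ≈E-trans)

  -- Trees and substitution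

  child : RTree → ℕ → RTree
  child t i p = t (i ∷ p)

  subtreeAt : RTree → List ℕ → RTree
  subtreeAt t q p = t (q ++ p)

  ≈ₜ-refl : ∀ {t} → t ≈ₜ t
  ≈ₜ-refl p = refl

  ≈ₜ-sym : ∀ {t u} → t ≈ₜ u → u ≈ₜ t
  ≈ₜ-sym e p = sym (e p)

  ≈ₜ-trans : ∀ {t u v} → t ≈ₜ u → u ≈ₜ v → t ≈ₜ v
  ≈ₜ-trans e f p = trans (e p) (f p)

  BelowDepth : (Maybe Lab → Maybe Lab → Set) → ℕ → RTree → RTree → Set
  BelowDepth R D s s′ = ∀ p → length p < D → R (s p) (s′ p)

  NotRule : Maybe Lab → Set
  NotRule m = ∀ μ → ¬ m ≡ just (inj₂ μ)

  fn≢rule : ∀ {f : Fin nsym} {μ : Rule} → just {A = Lab} (inj₁ f) ≢ just (inj₂ μ)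
  fn≢rule ()

  NoRootRedex : RTree → Set
  NoRootRedex t = NotRule (t [])

  NoRule-≈ : ∀ {t u} → NoRule t → t ≈ₜ u → NoRule u
  NoRule-≈ nr e p μ x = nr p μ (trans (e p) x)

  node-child : ∀ l ts i p (i<a : i < arity l) → node l ts (i ∷ p) ≡ ts (fromℕ< i<a) p
  node-child l ts i p i<a with i <? arity l
  ... | yes i<a′ = cong (λ h → ts (fromℕ< h) p) (<-irrelevant i<a′ i<a)
  ... | no ¬i<a = ⊥-elim (¬i<a i<a)

  node-outside : ∀ l ts i p → ¬ i < arity l → node l ts (i ∷ p) ≡ nothing
  node-outside l ts i p ¬i<a with i <? arity l
  ... | yes i<a = ⊥-elim (¬i<a i<a)
  ... | no _    = refl

  node-toℕ : ∀ l ts (j : Fin (arity l)) p → node l ts (toℕ j ∷ p) ≡ ts j p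
  node-toℕ l ts j p =
    trans (node-child l ts (toℕ j) p (toℕ<n j)) (cong (λ k → ts k p) (fromℕ<-toℕ j (toℕ<n j)))

  node-≈ : ∀ l {ts ts′ : Fin (arity l) → RTree} → (∀ i → ts i ≈ₜ ts′ i) → node l ts ≈ₜ node l ts′
  node-≈ l h []      = refl
  node-≈ l h (i ∷ p) with i <? arity l
  ... | yes i<a = h (fromℕ< i<a) p
  ... | no _    = refl

  substLab-app : ∀ {n} f (cs : Fin (ar f) → FTerm S n) σ →
                 substLab (app f cs) σ ≈ₜ node (inj₁ f) (λ i → substLab (cs i) σ)
  substLab-app f cs σ []      = refl
  substLab-app f cs σ (i ∷ p) with i <? ar f
  ... | yes _ = refl
  ... | no _  = refl

  substLab-≈ : ∀ {n} (C : FTerm S n) {σ σ′} → (∀ x → σ x ≈ₜ σ′ x) → substLab C σ ≈ₜ substLab C σ′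
  substLab-≈ (var x)    h p       = h x p
  substLab-≈ (app f cs) h []      = refl
  substLab-≈ (app f cs) h (i ∷ p) with i <? ar f
  ... | yes i<a = substLab-≈ (cs (fromℕ< i<a)) h p
  ... | no _    = refl

  substLab-app-toℕ : ∀ {n} f (cs : Fin (ar f) → FTerm S n) σ (i : Fin (ar f)) p →
                     substLab (app f cs) σ (toℕ i ∷ p) ≡ substLab (cs i) σ p
  substLab-app-toℕ f cs σ i p = trans (substLab-app f cs σ (toℕ i ∷ p)) (node-toℕ (inj₁ f) _ i p)

  data _occursIn_ {n : ℕ} : Fin n → FTerm S n → Set where
    here  : ∀ {x} → x occursIn var x
    there : ∀ {f cs x} (i : Fin (ar f)) → x occursIn cs i → x occursIn app f cs

  occursIn? : ∀ {n} (x : Fin n) C → Dec (x occursIn C)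
  occursIn? x (var y) with y ≟F x
  ... | yes refl = yes here
  ... | no y≢x   = no λ { here → y≢x refl }
  occursIn? x (app f cs) with any? (λ i → occursIn? x (cs i))
  ... | yes (i , o) = yes (there i o)
  ... | no ¬o       = no λ { (there i o) → ¬o (i , o) }

  occurrence : ∀ {n} {x : Fin n} {C} → x occursIn C → List ℕ
  occurrence here        = []
  occurrence (there i o) = toℕ i ∷ occurrence o

  graft-outside : ∀ u q s p → strip q p ≡ nothing → graft u q s p ≡ u p
  graft-outside u q s p e rewrite e = refl

  graft-≈ : ∀ u p {s s′} → s ≈ₜ s′ → graft u p s ≈ₜ graft u p s′
  graft-≈ u p e q with strip p q
  ... | just r  = e r
  ... | nothing = refl

  strip-short : ∀ p q → length q < length p → strip p q ≡ nothing
  strip-short (x ∷ p) []      _ = refl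
  strip-short (x ∷ p) (y ∷ q) (s≤s lq<lp) with x ≡ᵇ y
  ... | true  = strip-short p q lq<lp
  ... | false = refl

  putChild : RTree → ℕ → RTree → RTree
  putChild u j a = graft u (j ∷ []) a

  putChild-self : ∀ u j → u ≈ₜ putChild u j (child u j)
  putChild-self u j []      = refl
  putChild-self u j (i ∷ p) with j ≡ᵇ i in eq
  ... | true rewrite ≡ᵇ⇒≡ j i (Equivalence.from T-≡ eq) = refl
  ... | false = refl

  putChild-same : ∀ u j a → child (putChild u j a) j ≈ₜ a
  putChild-same u j a p rewrite ≡ᵇ-refl j = refl

  putChild-other : ∀ u j a i → j ≢ i → child (putChild u j a) i ≈ₜ child u i
  putChild-other u j a i j≢i p rewrite ≢⇒≡ᵇ-false j≢i = refl

  NoRule-node-fn : ∀ f {ts} → (∀ i → NoRule (ts i)) → NoRule (node (inj₁ f) ts)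
  NoRule-node-fn f h []      μ ()
  NoRule-node-fn f {ts} h (i ∷ p) μ e with i <? ar f
  ... | yes i<a = h (fromℕ< i<a) p μ e
  ... | no _    = nothing≢just e

  NoRule-substLab : ∀ {n} (C : FTerm S n) σ → (∀ x → x occursIn C → NoRule (σ x)) → NoRule (substLab C σ)
  NoRule-substLab (var x)    σ h = h x here
  NoRule-substLab (app f cs) σ h = NoRule-≈
    (NoRule-node-fn f (λ i → NoRule-substLab (cs i) σ (λ x o → h x (there i o)))) (≈ₜ-sym (substLab-app f cs σ))

  IsTree-≈ : ∀ {t u} → IsTree t → t ≈ₜ u → IsTree u
  IsTree-≈ {t} {u} it e = record
    { root   = λ z → IsTree.root it (trans (e []) z)
    ; child⇒ = λ p i present →
        let (l , tp≡l , i<a) = IsTree.child⇒ it p i (λ z → present (trans (sym (e _)) z))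
        in l , trans (sym (e p)) tp≡l , i<a
    ; ⇒child = λ p i l up≡l i<a absent → IsTree.⇒child it p i l (trans (e p) up≡l) i<a (trans (e _) absent) }

  IsTree-absent-child : ∀ {t} → IsTree t → ∀ q k → t q ≡ nothing → t (q ++ k ∷ []) ≡ nothing
  IsTree-absent-child {t} it q k tq≡nothing with t (q ++ k ∷ []) in eq
  ... | nothing = refl
  ... | just _  = let (_ , tq≡l , _) = IsTree.child⇒ it q k (λ z → nothing≢just (trans (sym z) eq))
                  in ⊥-elim (nothing≢just (trans (sym tq≡nothing) tq≡l))

  IsTree-absent-++ : ∀ {t} → IsTree t → ∀ q r → t q ≡ nothing → t (q ++ r) ≡ nothing
  IsTree-absent-++ it q []      tq≡nothing rewrite ++-identityʳ q = tq≡nothing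
  IsTree-absent-++ {t} it q (k ∷ r) tq≡nothing = subst (λ z → t z ≡ nothing) (++-assoc q (k ∷ []) r)
    (IsTree-absent-++ it (q ++ k ∷ []) r (IsTree-absent-child it q k tq≡nothing))

  IsTree-outside : ∀ {t l i} → IsTree t → t [] ≡ just l → arity l ≤ i → ∀ p → t (i ∷ p) ≡ nothing
  IsTree-outside {t} {l} {i} it root a≤i p = IsTree-absent-++ it (i ∷ []) p absent
    where
    absent : t (i ∷ []) ≡ nothing
    absent with t (i ∷ []) in eq
    ... | nothing = refl
    ... | just _ with IsTree.child⇒ it [] i (λ z → nothing≢just (trans (sym z) eq))
    ...   | (_ , root′ , i<a) rewrite just-injective (trans (sym root) root′) = ⊥-elim (≤⇒≯ a≤i i<a)

  IsTree-child : ∀ {t l i} → IsTree t → t [] ≡ just l → i < arity l → IsTree (child t i)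
  IsTree-child {i = i} it root i<a = record
    { root   = IsTree.⇒child it [] i _ root i<a
    ; child⇒ = λ p → IsTree.child⇒ it (i ∷ p)
    ; ⇒child = λ p → IsTree.⇒child it (i ∷ p) }

  IsTree-fromChildren : ∀ {u l} → u [] ≡ just l → (∀ i → i < arity l → IsTree (child u i)) →
                        (∀ i → arity l ≤ i → ∀ p → u (i ∷ p) ≡ nothing) → IsTree u
  IsTree-fromChildren {u} {l} root near far = record
    { root = λ z → nothing≢just (trans (sym z) root) ; child⇒ = child⇒ ; ⇒child = ⇒child }
    where
    child⇒ : ∀ p i → ¬ u (p ++ i ∷ []) ≡ nothing → Σ Lab λ l′ → u p ≡ just l′ × i < arity l′
    child⇒ []      i present with i <? arity l
    ... | yes i<a = l , root , i<a
    ... | no ¬i<a = ⊥-elim (present (far i (≮⇒≥ ¬i<a) []))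
    child⇒ (j ∷ p) i present with j <? arity l
    ... | yes j<a = IsTree.child⇒ (near j j<a) p i present
    ... | no ¬j<a = ⊥-elim (present (far j (≮⇒≥ ¬j<a) _))
    ⇒child : ∀ p i l′ → u p ≡ just l′ → i < arity l′ → ¬ u (p ++ i ∷ []) ≡ nothing
    ⇒child []      i l′ root′ i<a rewrite just-injective (trans (sym root) root′) = IsTree.root (near i i<a)
    ⇒child (j ∷ p) i l′ up≡l′ i<a with j <? arity l
    ... | yes j<a = IsTree.⇒child (near j j<a) p i l′ up≡l′ i<a
    ... | no ¬j<a = ⊥-elim (nothing≢just (trans (sym (far j (≮⇒≥ ¬j<a) p)) up≡l′))

  IsTree-node : ∀ l ts → (∀ j → IsTree (ts j)) → IsTree (node l ts)
  IsTree-node l ts h = IsTree-fromChildren refl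
    (λ i i<a → IsTree-≈ (h (fromℕ< i<a)) (λ p → sym (node-child l ts i p i<a)))
    (λ i a≤i p → node-outside l ts i p (≤⇒≯ a≤i))

  IsTree-substLab : ∀ {n} (C : FTerm S n) σ → (∀ x → IsTree (σ x)) → IsTree (substLab C σ)
  IsTree-substLab (var x)    σ h = h x
  IsTree-substLab (app f cs) σ h = IsTree-≈
    (IsTree-node (inj₁ f) _ (λ i → IsTree-substLab (cs i) σ h)) (≈ₜ-sym (substLab-app f cs σ))

  -- Strongly convergent reductions

  module _ {ρ : (μ : Rule) → FTerm S (rar μ)} where

    SCR-respˡ : ∀ {k a a′ b} → a′ ≈ₜ a → SCR ρ k a b → SCR ρ k a′ b
    SCR-respˡ e (nil f)                     = nil (≈ₜ-trans e f)
    SCR-respˡ e (snoc R p d st)             = snoc (SCR-respˡ e R) p d st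
    SCR-respˡ e (lim ss g e₀ segs kg g∞ L) = lim ss g (≈ₜ-trans e e₀) segs kg g∞ L

    SCR-respʳ : ∀ {k a b b′} → b ≈ₜ b′ → SCR ρ k a b → SCR ρ k a b′
    SCR-respʳ e (nil f)                        = nil (≈ₜ-trans f e)
    SCR-respʳ e (snoc R p d (μ , m , h))       = snoc R p d (μ , m , λ q → trans (sym (e q)) (h q))
    SCR-respʳ e (lim ss g e₀ segs kg g∞ L) = lim ss g e₀ segs kg g∞
      (λ k → proj₁ (L k) , λ i Ni p lp → trans (proj₂ (L k) i Ni p lp) (e p))

    SCR-weaken : ∀ {k k′ a b} → k′ ≤ k → SCR ρ k a b → SCR ρ k′ a b
    SCR-weaken k′≤k (nil f)                    = nil f
    SCR-weaken k′≤k (snoc R p d st)            = snoc (SCR-weaken k′≤k R) p (≤-trans k′≤k d) st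
    SCR-weaken k′≤k (lim ss g e segs kg g∞ L) = lim ss g e segs (λ i → ≤-trans k′≤k (kg i)) g∞ L

    SCR-trans : ∀ {k a b c} → SCR ρ k a b → SCR ρ k b c → SCR ρ k a c
    SCR-trans R (nil f)         = SCR-respʳ f R
    SCR-trans R (snoc R′ p d st) = snoc (SCR-trans R R′) p d st
    SCR-trans {k} {a} {c = c} R (lim ss g e segs kg g∞ L) = lim ss′ g′ ≈ₜ-refl segs′ kg′ g∞′ L′
      where
      ss′ : ℕ → RTree
      ss′ zero    = a
      ss′ (suc i) = ss i
      g′ : ℕ → ℕ
      g′ zero    = k
      g′ (suc i) = g i
      segs′ : ∀ i → SCR ρ (g′ i) (ss′ i) (ss′ (suc i))
      segs′ zero    = SCR-respʳ e R
      segs′ (suc i) = segs i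
      kg′ : ∀ i → k ≤ g′ i
      kg′ zero    = ≤-refl
      kg′ (suc i) = kg i
      g∞′ : ∀ m → Σ ℕ λ N → ∀ i → N ≤ i → m ≤ g′ i
      g∞′ m = suc (proj₁ (g∞ m)) , λ { (suc i) (s≤s N≤i) → proj₂ (g∞ m) i N≤i }
      L′ : Lim ss′ c
      L′ d = suc (proj₁ (L d)) , λ { (suc i) (s≤s N≤i) → proj₂ (L d) i N≤i }

    SCR-stable : ∀ {k a b} → SCR ρ k a b → BelowDepth _≡_ k a b
    SCR-stable (nil f) p _ = f p
    SCR-stable (snoc {u = u} R q d (μ , m , h)) p lp =
      trans (SCR-stable R p lp) (sym (trans (h p) (graft-outside u q _ p (strip-short q p (<-≤-trans lp d)))))
    SCR-stable {a = a} (lim ss g e segs kg g∞ L) p lp =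
      trans (upTo (proj₁ (L (length p)))) (proj₂ (L (length p)) _ ≤-refl p ≤-refl)
      where
      upTo : ∀ i → a p ≡ ss i p
      upTo zero    = e p
      upTo (suc i) = trans (upTo i) (SCR-stable (segs i) p (<-≤-trans lp (kg i)))

    Step-putChild : ∀ {a p b} u j → Step ρ a p b → Step ρ (putChild u j a) (j ∷ p) (putChild u j b)
    Step-putChild {a} {p} {b} u j (μ , m , h) = μ , m′ , h′
      where
      m′ : putChild u j a (j ∷ p) ≡ just (inj₂ μ)
      m′ rewrite ≡ᵇ-refl j = m
      h′ : ∀ q → putChild u j b q ≡ graft (putChild u j a) (j ∷ p)
                   (substLab (ρ μ) (λ i q′ → putChild u j a ((j ∷ p) ++ toℕ i ∷ q′))) q
      h′ []      = refl
      h′ (i ∷ q) with j ≡ᵇ i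
      ... | false = refl
      ... | true  = trans (h q) (graft-≈ a p
                      (substLab-≈ (ρ μ) (λ x q′ → sym (putChild-same u j a (p ++ toℕ x ∷ q′)))) q)

    SCR-putChild : ∀ {k a b} u j → SCR ρ k a b → SCR ρ (suc k) (putChild u j a) (putChild u j b)
    SCR-putChild u j (nil f)         = nil (graft-≈ u (j ∷ []) f)
    SCR-putChild u j (snoc R p d st) = snoc (SCR-putChild u j R) (j ∷ p) (s≤s d) (Step-putChild u j st)
    SCR-putChild {b = b} u j (lim ss g e segs kg g∞ L) =
      lim (λ i → putChild u j (ss i)) (λ i → suc (g i)) (graft-≈ u (j ∷ []) e)
          (λ i → SCR-putChild u j (segs i)) (λ i → s≤s (kg i))
          (λ m → proj₁ (g∞ m) , λ i N≤i → ≤-trans (proj₂ (g∞ m) i N≤i) (n≤1+n _))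
          (λ d → proj₁ (L d) , limit d)
      where
      limit : ∀ d i → proj₁ (L d) ≤ i → ∀ p → length p ≤ d → putChild u j (ss i) p ≡ putChild u j b p
      limit d i N≤i []       _  = refl
      limit d i N≤i (i′ ∷ p) lp with j ≡ᵇ i′
      ... | true  = proj₂ (L d) i N≤i p (≤-trans (n≤1+n _) lp)
      ... | false = refl

    SCR-children : ∀ {k} n u u′ → u [] ≡ u′ [] →
                   (∀ i → i < n → SCR ρ k (child u i) (child u′ i)) →
                   (∀ i → n ≤ i → child u i ≈ₜ child u′ i) → SCR ρ (suc k) u u′
    SCR-children zero    u u′ root near far = nil λ { [] → root ; (i ∷ p) → far i z≤n p }
    SCR-children {k} (suc n) u u′ root near far =
      SCR-trans (SCR-respˡ (putChild-self u n) (SCR-putChild u n (near n ≤-refl)))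
                (SCR-children n v u′ root near′ far′)
      where
      v : RTree
      v = putChild u n (child u′ n)
      near′ : ∀ i → i < n → SCR ρ k (child v i) (child u′ i)
      near′ i i<n = SCR-respˡ (putChild-other u n (child u′ n) i (λ e → <⇒≢ i<n (sym e)))
                              (near i (≤-trans i<n (n≤1+n _)))
      far′ : ∀ i → n ≤ i → child v i ≈ₜ child u′ i
      far′ i n≤i with m≤n⇒m<n∨m≡n n≤i
      ... | inj₂ refl = putChild-same u n (child u′ n)
      ... | inj₁ n<i  = ≈ₜ-trans (putChild-other u n (child u′ n) i (<⇒≢ n<i)) (far i n<i)

    SCR-node : ∀ {k} l {ts ts′ : Fin (arity l) → RTree} → (∀ i → SCR ρ k (ts i) (ts′ i)) →
               SCR ρ (suc k) (node l ts) (node l ts′)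
    SCR-node l {ts} {ts′} h = SCR-children (arity l) _ _ refl near far
      where
      near : ∀ i → (i<a : i < arity l) → SCR ρ _ (child (node l ts) i) (child (node l ts′) i)
      near i i<a = SCR-respˡ (λ p → node-child l ts i p i<a) (SCR-respʳ (λ p → sym (node-child l ts′ i p i<a)) (h _))
      far : ∀ i → arity l ≤ i → child (node l ts) i ≈ₜ child (node l ts′) i
      far i a≤i p = trans (node-outside l ts i p (≤⇒≯ a≤i)) (sym (node-outside l ts′ i p (≤⇒≯ a≤i)))

    mutual
      SCR-substLab : ∀ {k n} (C : FTerm S n) {σ σ′} → (∀ x → x occursIn C → SCR ρ k (σ x) (σ′ x)) →
                     SCR ρ k (substLab C σ) (substLab C σ′)
      SCR-substLab (var x)    h = h x here
      SCR-substLab (app f cs) h = SCR-weaken (n≤1+n _) (SCR-substLab-app f cs h)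

      SCR-substLab-app : ∀ {k n} f (cs : Fin (ar f) → FTerm S n) {σ σ′} →
                         (∀ x → x occursIn app f cs → SCR ρ k (σ x) (σ′ x)) →
                         SCR ρ (suc k) (substLab (app f cs) σ) (substLab (app f cs) σ′)
      SCR-substLab-app f cs {σ} {σ′} h =
        SCR-respˡ (substLab-app f cs σ) (SCR-respʳ (≈ₜ-sym (substLab-app f cs σ′))
          (SCR-node (inj₁ f) (λ i → SCR-substLab (cs i) (λ x o → h x (there i o)))))

    Step-child : ∀ {u j p b} → Step ρ u (j ∷ p) b → Step ρ (child u j) p (child b j)
    Step-child {u} {j} {p} {b} (μ , m , h) = μ , m , λ q → trans (h (j ∷ q)) (descend q)
      where
      descend : ∀ q → graft u (j ∷ p) (substLab (ρ μ) (λ i q′ → u ((j ∷ p) ++ toℕ i ∷ q′))) (j ∷ q) ≡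
                      graft (child u j) p (substLab (ρ μ) (λ i q′ → child u j (p ++ toℕ i ∷ q′))) q
      descend q rewrite ≡ᵇ-refl j = refl

    Step-otherChild : ∀ {u j′ p b} j → Step ρ u (j′ ∷ p) b → j′ ≢ j → child b j ≈ₜ child u j
    Step-otherChild {u} {j′} {p} j (μ , m , h) j′≢j q =
      trans (h (j ∷ q)) (graft-outside u (j′ ∷ p) _ (j ∷ q) outside)
      where
      outside : strip (j′ ∷ p) (j ∷ q) ≡ nothing
      outside rewrite ≢⇒≡ᵇ-false j′≢j = refl

    SCR-child : ∀ {k a b} j → SCR ρ k a b → 1 ≤ k → SCR ρ (pred k) (child a j) (child b j)
    SCR-child j (nil f) _ = nil (λ p → f (j ∷ p))
    SCR-child j (snoc R [] d st) 1≤k = ⊥-elim (≤⇒≯ d 1≤k)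
    SCR-child j (snoc R (j′ ∷ p) d st) 1≤k with j′ ≟ j
    ... | yes refl = snoc (SCR-child j R 1≤k) p (pred-mono-≤ d) (Step-child st)
    ... | no j′≢j  = SCR-respʳ (≈ₜ-sym (Step-otherChild j st j′≢j)) (SCR-child j R 1≤k)
    SCR-child j (lim ss g e segs kg g∞ L) 1≤k =
      lim (λ i → child (ss i) j) (λ i → pred (g i)) (λ p → e (j ∷ p))
        (λ i → SCR-child j (segs i) (≤-trans 1≤k (kg i))) (λ i → pred-mono-≤ (kg i))
        (λ m → proj₁ (g∞ (suc m)) , λ i N≤i → pred-mono-≤ (proj₂ (g∞ (suc m)) i N≤i))
        (λ d → proj₁ (L (suc d)) , λ i N≤i p lp → proj₂ (L (suc d)) i N≤i (j ∷ p) (s≤s lp))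

    RootSplit : RTree → RTree → Set
    RootSplit a b = SCR ρ 1 a b ⊎ (Σ RTree λ u → Σ RTree λ v → SCR ρ 1 a u × Step ρ u [] v × SCR ρ 0 v b)

    -- At a limit, strong convergence leaves only finitely many segments that may touch the root.
    SCR-rootSplit : ∀ {k a b} → SCR ρ k a b → RootSplit a b
    SCR-rootSplit (nil f) = inj₁ (nil f)
    SCR-rootSplit (snoc R p d st) with SCR-rootSplit R | p
    ... | inj₁ R₁ | []     = inj₂ (_ , _ , R₁ , st , nil ≈ₜ-refl)
    ... | inj₁ R₁ | j ∷ p′ = inj₁ (snoc R₁ (j ∷ p′) (s≤s z≤n) st)
    ... | inj₂ (u , v , R₁ , root , R₂) | p′ = inj₂ (u , v , R₁ , root , snoc R₂ p′ z≤n st)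
    SCR-rootSplit {b = b} (lim ss g e segs kg g∞ L) = combine (prefix N)
      where
      N : ℕ
      N = proj₁ (g∞ 1)
      prefix : ∀ m → RootSplit (ss 0) (ss m)
      prefix zero = inj₁ (nil ≈ₜ-refl)
      prefix (suc m) with prefix m
      ... | inj₂ (u , v , R₁ , root , R₂) = inj₂ (u , v , R₁ , root , SCR-trans R₂ (SCR-weaken z≤n (segs m)))
      ... | inj₁ R₁ with SCR-rootSplit (segs m)
      ...   | inj₁ S                          = inj₁ (SCR-trans R₁ S)
      ...   | inj₂ (u , v , S₁ , root , S₂) = inj₂ (u , v , SCR-trans R₁ S₁ , root , S₂)
      suffix : ∀ k → (∀ i → N ≤ i → k ≤ g i) → SCR ρ k (ss N) b
      suffix k k≤g = lim (λ i → ss (i + N)) (λ i → g (i + N)) ≈ₜ-refl (λ i → segs (i + N))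
        (λ i → k≤g (i + N) (m≤n+m N i))
        (λ m → proj₁ (g∞ m) , λ i M≤i → proj₂ (g∞ m) (i + N) (≤-trans M≤i (m≤m+n i N)))
        (λ d → proj₁ (L d) , λ i M≤i → proj₂ (L d) (i + N) (≤-trans M≤i (m≤m+n i N)))
      combine : RootSplit (ss 0) (ss N) → RootSplit _ b
      combine (inj₁ R₁) = inj₁ (SCR-respˡ e (SCR-trans R₁ (suffix 1 (proj₂ (g∞ 1)))))
      combine (inj₂ (u , v , R₁ , root , R₂)) =
        inj₂ (u , v , SCR-respˡ e R₁ , root , SCR-trans R₂ (suffix 0 (λ _ _ → z≤n)))

    SCR-belowRoot : ∀ {k a b} → SCR ρ k a b → NoRootRedex a → SCR ρ 1 a b
    SCR-belowRoot R noRedex with SCR-rootSplit R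
    ... | inj₁ R₁ = R₁
    ... | inj₂ (_ , _ , R₁ , (μ , m , _) , _) = ⊥-elim (noRedex μ (trans (SCR-stable R₁ [] (s≤s z≤n)) m))

    SCR-atOccurrence : ∀ {n} {C : FTerm S n} {x} (o : x occursIn C) σ {a b} → a ≈ₜ substLab C σ →
                       SCR ρ 0 a b → SCR ρ 0 (σ x) (subtreeAt b (occurrence o))
    SCR-atOccurrence here σ e R = SCR-respˡ (≈ₜ-sym e) R
    SCR-atOccurrence {C = app f cs} (there i o) σ e R =
      SCR-atOccurrence o σ (λ p → trans (e (toℕ i ∷ p)) (substLab-app-toℕ f cs σ i p))
        (SCR-child (toℕ i) (SCR-belowRoot R (λ μ fn≡μ → fn≢rule (trans (sym (e [])) fn≡μ))) (s≤s z≤n))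

  -- The source of a multistep

  record ReflexiveOnFn (R : Maybe Lab → Maybe Lab → Set) : Set where
    field
      nothing-refl : R nothing nothing
      fn-refl      : ∀ f → R (just (inj₁ f)) (just (inj₁ f))
  open ReflexiveOnFn

  mutual
    BelowDepth-substLab : ∀ {R} → ReflexiveOnFn R → ∀ {n} (C : FTerm S n) {σ σ′ D} →
                          (∀ x → BelowDepth R D (σ x) (σ′ x)) → BelowDepth R D (substLab C σ) (substLab C σ′)
    BelowDepth-substLab r (var x)    h = h x
    BelowDepth-substLab r (app f cs) h p lp = BelowDepth-substLab-app r f cs h p (≤-trans lp (n≤1+n _))

    BelowDepth-substLab-app : ∀ {R} → ReflexiveOnFn R → ∀ {n} f (cs : Fin (ar f) → FTerm S n) {σ σ′ D} →
                              (∀ x → BelowDepth R D (σ x) (σ′ x)) →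
                              BelowDepth R (suc D) (substLab (app f cs) σ) (substLab (app f cs) σ′)
    BelowDepth-substLab-app r f cs h []      _        = fn-refl r f
    BelowDepth-substLab-app r f cs h (i ∷ p) (s≤s lp) with i <? ar f
    ... | yes i<a = BelowDepth-substLab r (cs (fromℕ< i<a)) h p lp
    ... | no _    = nothing-refl r

  BelowDepth-substLab-lhs : ∀ {R} → ReflexiveOnFn R → ∀ μ {σ σ′ D} → (∀ x → BelowDepth R D (σ x) (σ′ x)) →
                            BelowDepth R (suc D) (substLab (lhs μ) σ) (substLab (lhs μ) σ′)
  BelowDepth-substLab-lhs r μ h with lhs μ | lhs-nonvar μ
  ... | var x    | nonvar = ⊥-elim (nonvar tt)
  ... | app f cs | _      = BelowDepth-substLab-app r f cs h

  ≡-ReflexiveOnFn : ReflexiveOnFn _≡_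
  ≡-ReflexiveOnFn = record { nothing-refl = refl ; fn-refl = λ _ → refl }

  NotRule-ReflexiveOnFn : ReflexiveOnFn (λ _ m → NotRule m)
  NotRule-ReflexiveOnFn = record { nothing-refl = λ _ () ; fn-refl = λ _ _ () }

  -- Outside the arity of f the fallback tree d is copied, so no IsTree hypothesis is needed.
  fnode : Fin nsym → (ℕ → RTree) → RTree → RTree
  fnode f ch d []      = just (inj₁ f)
  fnode f ch d (i ∷ p) with i <? ar f
  ... | yes _ = ch i p
  ... | no _  = d (i ∷ p)

  fnode-child : ∀ f ch d i p → i < ar f → fnode f ch d (i ∷ p) ≡ ch i p
  fnode-child f ch d i p i<a with i <? ar f
  ... | yes _   = refl
  ... | no ¬i<a = ⊥-elim (¬i<a i<a)

  fnode-outside : ∀ f ch d i p → ¬ i < ar f → fnode f ch d (i ∷ p) ≡ d (i ∷ p)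
  fnode-outside f ch d i p ¬i<a with i <? ar f
  ... | yes i<a = ⊥-elim (¬i<a i<a)
  ... | no _    = refl

  -- approx n t unfolds every rule symbol of t at depth < n into its left-hand side (μ(x⃗) → l[x⃗]).
  mutual
    approx : ℕ → RTree → RTree
    approx zero    t = t
    approx (suc n) t = approxRoot n t (t [])

    approxRoot : ℕ → RTree → Maybe Lab → RTree
    approxRoot n t nothing         = t
    approxRoot n t (just (inj₁ f)) = fnode f (λ i → approx n (child t i)) t
    approxRoot n t (just (inj₂ μ)) = substLab (lhs μ) (λ j → approx n (child t (toℕ j)))

  approx-step₀ : ∀ t m → t [] ≡ m → SCR lhs 0 t (approxRoot 0 t m)
  approx-step₀ t nothing         _    = nil ≈ₜ-refl
  approx-step₀ t (just (inj₁ f)) root = nil same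
    where
    same : t ≈ₜ fnode f (child t) t
    same []      = root
    same (i ∷ p) with i <? ar f
    ... | yes _ = refl
    ... | no _  = refl
  approx-step₀ t (just (inj₂ μ)) root = snoc (nil ≈ₜ-refl) [] z≤n (μ , root , λ _ → refl)

  mutual
    approx-step : ∀ n t → SCR lhs n (approx n t) (approx (suc n) t)
    approx-step zero    t = approx-step₀ t (t []) refl
    approx-step (suc n) t = approxRoot-step n t (t [])

    approxRoot-step : ∀ n t m → SCR lhs (suc n) (approxRoot n t m) (approxRoot (suc n) t m)
    approxRoot-step n t nothing         = nil ≈ₜ-refl
    approxRoot-step n t (just (inj₁ f)) = SCR-children (ar f) _ _ refl near far
      where
      near : ∀ i → i < ar f → SCR lhs n (child (fnode f (λ i → approx n (child t i)) t) i)
                                         (child (fnode f (λ i → approx (suc n) (child t i)) t) i)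
      near i i<a = SCR-respˡ (λ p → fnode-child f _ t i p i<a)
                     (SCR-respʳ (λ p → sym (fnode-child f _ t i p i<a)) (approx-step n (child t i)))
      far : ∀ i → ar f ≤ i → child (fnode f (λ i → approx n (child t i)) t) i
                                ≈ₜ child (fnode f (λ i → approx (suc n) (child t i)) t) i
      far i a≤i p = trans (fnode-outside f _ t i p (≤⇒≯ a≤i)) (sym (fnode-outside f _ t i p (≤⇒≯ a≤i)))
    approxRoot-step n t (just (inj₂ μ)) = lhs-step μ
      where
      lhs-step : ∀ μ → SCR lhs (suc n) (substLab (lhs μ) (λ j → approx n (child t (toℕ j))))
                                         (substLab (lhs μ) (λ j → approx (suc n) (child t (toℕ j))))
      lhs-step μ with lhs μ | lhs-nonvar μ
      ... | var x    | nonvar = ⊥-elim (nonvar tt)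
      ... | app f cs | _      = SCR-substLab-app f cs (λ x _ → approx-step n (child t (toℕ x)))

  mutual
    approx-stable : ∀ n m t → n ≤ m → BelowDepth _≡_ n (approx n t) (approx m t)
    approx-stable (suc n) (suc m) t (s≤s n≤m) = approxRoot-stable n m t (t []) n≤m

    approxRoot-stable : ∀ n m t l → n ≤ m → BelowDepth _≡_ (suc n) (approxRoot n t l) (approxRoot m t l)
    approxRoot-stable n m t nothing         n≤m p       _  = refl
    approxRoot-stable n m t (just (inj₁ f)) n≤m []      _  = refl
    approxRoot-stable n m t (just (inj₁ f)) n≤m (i ∷ p) lp with i <? ar f
    ... | yes _ = approx-stable n m (child t i) n≤m p (s≤s⁻¹ lp)
    ... | no _  = refl
    approxRoot-stable n m t (just (inj₂ μ)) n≤m =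
      BelowDepth-substLab-lhs ≡-ReflexiveOnFn μ (λ x → approx-stable n m (child t (toℕ x)) n≤m)

  NoRuleBelow : ℕ → RTree → Set
  NoRuleBelow D s = ∀ p → length p < D → NotRule (s p)

  mutual
    approx-NoRuleBelow : ∀ {t} → IsTree t → ∀ n → NoRuleBelow n (approx n t)
    approx-NoRuleBelow {t} it (suc n) = approxRoot-NoRuleBelow it n (t []) refl

    approxRoot-NoRuleBelow : ∀ {t} → IsTree t → ∀ n l → t [] ≡ l → NoRuleBelow (suc n) (approxRoot n t l)
    approxRoot-NoRuleBelow it n nothing         root = ⊥-elim (IsTree.root it root)
    approxRoot-NoRuleBelow it n (just (inj₁ f)) root []      _  = λ _ ()
    approxRoot-NoRuleBelow {t} it n (just (inj₁ f)) root (i ∷ p) lp with i <? ar f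
    ... | yes i<a = approx-NoRuleBelow (IsTree-child it root i<a) n p (s≤s⁻¹ lp)
    ... | no ¬i<a = λ μ e → nothing≢just (trans (sym (IsTree-outside it root (≮⇒≥ ¬i<a) p)) e)
    approxRoot-NoRuleBelow {t} it n (just (inj₂ μ)) root =
      BelowDepth-substLab-lhs NotRule-ReflexiveOnFn μ
        {σ = λ j → approx n (child t (toℕ j))} {σ′ = λ j → approx n (child t (toℕ j))}
        (λ x → approx-NoRuleBelow (IsTree-child it root (toℕ<n x)) n)

  mutual
    approx-IsTree : ∀ {t} → IsTree t → ∀ n → IsTree (approx n t)
    approx-IsTree it zero        = it
    approx-IsTree {t} it (suc n) = approxRoot-IsTree it n (t []) refl

    approxRoot-IsTree : ∀ {t} → IsTree t → ∀ n l → t [] ≡ l → IsTree (approxRoot n t l)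
    approxRoot-IsTree it n nothing root = ⊥-elim (IsTree.root it root)
    approxRoot-IsTree {t} it n (just (inj₁ f)) root = IsTree-fromChildren refl
      (λ i i<a → IsTree-≈ (approx-IsTree (IsTree-child it root i<a) n) (λ p → sym (fnode-child f _ t i p i<a)))
      (λ i a≤i p → trans (fnode-outside f _ t i p (≤⇒≯ a≤i)) (IsTree-outside it root a≤i p))
    approxRoot-IsTree {t} it n (just (inj₂ μ)) root =
      IsTree-substLab (lhs μ) _ (λ j → approx-IsTree (IsTree-child it root (toℕ<n j)) n)

  -- The source src(ms t): position p has stabilised at stage |p| + 1 of the approximation.
  source : RTree → RTree
  source t p = approx (suc (length p)) t p

  approx-source : ∀ t n p → length p < n → approx n t p ≡ source t p
  approx-source t n p lp = sym (approx-stable (suc (length p)) n t lp p ≤-refl)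

  source-SCR : ∀ t → SCR lhs 0 t (source t)
  source-SCR t = lim (λ n → approx n t) (λ n → n) ≈ₜ-refl (λ n → approx-step n t) (λ _ → z≤n)
    (λ m → m , λ _ m≤i → m≤i) (λ d → suc d , λ i d<i p lp → approx-source t i p (<-≤-trans (s≤s lp) d<i))

  source-NoRule : ∀ {t} → IsTree t → NoRule (source t)
  source-NoRule it p = approx-NoRuleBelow it (suc (length p)) p ≤-refl

  source-IsTree : ∀ {t} → IsTree t → IsTree (source t)
  source-IsTree {t} it = record
    { root   = IsTree.root (approx-IsTree it 1)
    ; child⇒ = λ p i present →
        let (l , e , i<a) = IsTree.child⇒ (stage p) p i (λ z → present (trans (sym (extend p i)) z))
        in l , trans (sym (approx-source t _ p (n≤1+n _))) e , i<a
    ; ⇒child = λ p i l e i<a absent →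
        IsTree.⇒child (stage p) p i l (trans (approx-source t _ p (n≤1+n _)) e) i<a
          (trans (extend p i) absent) }
    where
    stage : ∀ p → IsTree (approx (suc (suc (length p))) t)
    stage p = approx-IsTree it (suc (suc (length p)))
    extend : ∀ p i → approx (suc (suc (length p))) t (p ++ i ∷ []) ≡ source t (p ++ i ∷ [])
    extend p i = cong (λ n → approx (suc n) t (p ++ i ∷ [])) (sym (trans (length-++ p) (+-comm (length p) 1)))

  source-root : ∀ t μ → t [] ≡ just (inj₂ μ) → source t ≈ₜ substLab (lhs μ) (λ j → source (child t (toℕ j)))
  source-root t μ root p = trans (cong (λ l → approxRoot (length p) t l p) root)
    (BelowDepth-substLab-lhs ≡-ReflexiveOnFn μ (λ x q lq → approx-source (child t (toℕ x)) (length p) q lq) p ≤-refl)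

  -- Convergence of the contractum

  -- A reduction to a rule-free term must contract the root redex μ; before that step it projects
  -- to the argument x, after it to the occurrence of x in the contractum.
  Conv-argument : ∀ {t μ} → t [] ≡ just (inj₂ μ) → Conv (ms t) →
                  ∀ x → x occursIn rhs μ → Conv (ms (child t (toℕ x)))
  Conv-argument {t} {μ} root (s , noRule , R) x o with SCR-rootSplit R
  ... | inj₁ R₁ = ⊥-elim (noRule [] μ (trans (sym (SCR-stable R₁ [] (s≤s z≤n))) root))
  ... | inj₂ (u , v , R₁ , (μ′ , m , h) , R₂)
        with inj₂-injective (just-injective (trans (sym m) (trans (sym (SCR-stable R₁ [] (s≤s z≤n))) root)))
  ...   | refl = subtreeAt s (occurrence o) , (λ p → noRule (occurrence o ++ p)) ,
                 SCR-trans (SCR-child (toℕ x) R₁ (s≤s z≤n)) (SCR-atOccurrence o (λ j → child u (toℕ j)) h R₂)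

  Conv-contractum : ∀ {t μ} → t [] ≡ just (inj₂ μ) → Conv (ms t) →
                    Conv (ms (substLab (rhs μ) (λ j → child t (toℕ j))))
  Conv-contractum {t} {μ} root cv =
    substLab (rhs μ) (λ x → proj₁ (target x)) ,
    NoRule-substLab (rhs μ) _ (λ x o → proj₁ (proj₂ (target x) o)) ,
    SCR-substLab (rhs μ) (λ x o → proj₂ (proj₂ (target x) o))
    where
    target : ∀ x → Σ RTree λ s → x occursIn rhs μ → NoRule s × SCR rhs 0 (child t (toℕ x)) s
    target x with occursIn? x (rhs μ)
    ... | yes o = proj₁ (Conv-argument root cv x o) , λ _ → proj₂ (Conv-argument root cv x o)
    ... | no ¬o = child t (toℕ x) , λ o → ⊥-elim (¬o o)

  -- Collapse chains

  NotCollapsing : Maybe Lab → Set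
  NotCollapsing l = ∀ μ x → l ≡ just (inj₂ μ) → rhs μ ≢ var x

  data FiniteCollapse : RTree → Set where
    halt : ∀ {t} → NotCollapsing (t []) → FiniteCollapse t
    next : ∀ {t μ x} → t [] ≡ just (inj₂ μ) → rhs μ ≡ var x →
           FiniteCollapse (child t (toℕ x)) → FiniteCollapse t

  collapseLength : ∀ {t} → FiniteCollapse t → ℕ
  collapseLength (halt _)     = 0
  collapseLength (next _ _ c) = suc (collapseLength c)

  FiniteCollapse-agree : ∀ {a b} (c : FiniteCollapse a) → BelowDepth _≡_ (suc (collapseLength c)) a b →
                         FiniteCollapse b
  FiniteCollapse-agree (halt nc) agree =
    halt λ μ x root → nc μ x (trans (agree [] (s≤s z≤n)) root)
  FiniteCollapse-agree (next {x = x} root collapsing c) agree =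
    next (trans (sym (agree [] (s≤s z≤n))) root) collapsing
         (FiniteCollapse-agree c (λ p lp → agree (toℕ x ∷ p) (s≤s lp)))

  FiniteCollapse-≈ : ∀ {a b} → FiniteCollapse a → a ≈ₜ b → FiniteCollapse b
  FiniteCollapse-≈ c e = FiniteCollapse-agree c (λ p _ → e p)

  FiniteCollapse-rootStep : ∀ {u b μ} → u [] ≡ just (inj₂ μ) → ∀ C → rhs μ ≡ C →
                            b ≈ₜ substLab C (λ j → child u (toℕ j)) → FiniteCollapse b → FiniteCollapse u
  FiniteCollapse-rootStep root (var x)    collapsing e c = next root collapsing (FiniteCollapse-≈ c e)
  FiniteCollapse-rootStep root (app g cs) rhs≡app   e c = halt notCollapsing
    where
    notCollapsing : NotCollapsing _
    notCollapsing μ′ x root′ collapsing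
      with inj₂-injective (just-injective (trans (sym root) root′))
    ... | refl with trans (sym rhs≡app) collapsing
    ...   | ()

  FiniteCollapse-step : ∀ {u p b} → Step rhs u p b → FiniteCollapse b → FiniteCollapse u
  FiniteCollapse-step {p = []} (μ , m , h) c = FiniteCollapse-rootStep m (rhs μ) refl h c
  FiniteCollapse-step {p = j ∷ p} (_ , _ , h) (halt nc) =
    halt λ μ x root → nc μ x (trans (h []) root)
  FiniteCollapse-step {p = j ∷ p} st@(_ , _ , h) (next {x = x} root collapsing c) with j ≟ toℕ x
  ... | yes refl = next (trans (sym (h [])) root) collapsing (FiniteCollapse-step (Step-child {ρ = rhs} st) c)
  ... | no j≢x   = next (trans (sym (h [])) root) collapsing
                        (FiniteCollapse-≈ c (Step-otherChild {ρ = rhs} (toℕ x) st j≢x))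

  -- A collapse chain only inspects a finite prefix, which is reached at some stage of a limit.
  FiniteCollapse-SCR : ∀ {k a b} → SCR rhs k a b → FiniteCollapse b → FiniteCollapse a
  FiniteCollapse-SCR (nil f)         c = FiniteCollapse-≈ c (≈ₜ-sym f)
  FiniteCollapse-SCR (snoc R p d st) c = FiniteCollapse-SCR R (FiniteCollapse-step st c)
  FiniteCollapse-SCR (lim ss g e segs kg g∞ L) c = FiniteCollapse-≈ (back N atN) (≈ₜ-sym e)
    where
    N : ℕ
    N = proj₁ (L (collapseLength c))
    atN : FiniteCollapse (ss N)
    atN = FiniteCollapse-agree c (λ p lp → sym (proj₂ (L (collapseLength c)) N ≤-refl p (s≤s⁻¹ lp)))
    back : ∀ i → FiniteCollapse (ss i) → FiniteCollapse (ss 0)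
    back zero    c′ = c′
    back (suc i) c′ = back i (FiniteCollapse-SCR (segs i) c′)

  Conv⇒FiniteCollapse : ∀ {t} → Conv (ms t) → FiniteCollapse t
  Conv⇒FiniteCollapse (s , noRule , R) = FiniteCollapse-SCR R (halt λ μ x root _ → noRule [] μ root)

  -- Factorisation into root steps

  smartRl-ms : ∀ μ ts → smartRl μ (λ i → ms (ts i)) ≡ ms (node (inj₂ μ) ts)
  smartRl-ms μ ts rewrite allFin-true (rar μ) (λ _ → true) (λ _ → refl) = refl

  smartFn-ms : ∀ f ψs → (∀ i → isMSb (ψs i) ≡ true) → smartFn f ψs ≡ ms (node (inj₁ f) (λ i → getT (ψs i)))
  smartFn-ms f ψs h rewrite allFin-true (ar f) (λ i → isMSb (ψs i)) h = refl

  substPT-ms : ∀ {n} (C : FTerm S n) ts → Σ RTree λ u → substPT C (λ j → ms (ts j)) ≡ ms u × u ≈ₜ substLab C ts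
  substPT-ms (var x)    ts = ts x , refl , ≈ₜ-refl
  substPT-ms (app f cs) ts =
    node (inj₁ f) (λ i → getT (ψ i)) , smartFn-ms f ψ (λ i → cong isMSb (proj₁ (proj₂ (substPT-ms (cs i) ts)))) ,
    ≈ₜ-trans (node-≈ (inj₁ f) agree) (≈ₜ-sym (substLab-app f cs ts))
    where
    ψ : Fin (ar f) → PT
    ψ i = substPT (cs i) (λ j → ms (ts j))
    agree : ∀ i → getT (ψ i) ≈ₜ substLab (cs i) ts
    agree i p = let (_ , ψ≡ms , u≈) = substPT-ms (cs i) ts in trans (cong (λ z → getT z p) ψ≡ms) (u≈ p)

  record ConvPT (χ : PT) (a b : RTree) : Set where
    field
      isPT : IsPT χ
      conv : Conv χ
      src  : Src χ a
      tgt  : Tgt χ b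

  IsPT-∙ : ∀ {χ ψ a b} → ConvPT χ a b → IsPT ψ → Src ψ b → IsPT (χ ∙ ψ)
  IsPT-∙ {b = b} c isPTψ srcψ = cat (ConvPT.isPT c) isPTψ (ConvPT.conv c) (b , ConvPT.tgt c , srcψ)

  ConvPT-∙ : ∀ {χ ψ a b c} → ConvPT χ a b → ConvPT ψ b c → ConvPT (χ ∙ ψ) a c
  ConvPT-∙ χ ψ = record
    { isPT = IsPT-∙ χ (ConvPT.isPT ψ) (ConvPT.src ψ) ; conv = ConvPT.conv ψ
    ; src = ConvPT.src χ ; tgt = ConvPT.tgt ψ }

  ConvPT-null : ∀ {s} → IsTree s → NoRule s → ConvPT (ms s) s s
  ConvPT-null it noRule = record
    { isPT = ms it ; conv = _ , noRule , nil ≈ₜ-refl ; src = noRule , nil ≈ₜ-refl ; tgt = noRule , nil ≈ₜ-refl }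

  ConvPT-ms-tgt-≈ : ∀ {r a b b′} → ConvPT (ms r) a b → b ≈ₜ b′ → ConvPT (ms r) a b′
  ConvPT-ms-tgt-≈ c e = record
    { isPT = ConvPT.isPT c ; conv = ConvPT.conv c ; src = ConvPT.src c
    ; tgt = NoRule-≈ (proj₁ (ConvPT.tgt c)) e , SCR-respʳ e (proj₂ (ConvPT.tgt c)) }

  prefix-≈E : ∀ {o ψ χ φ a b} → ConvPT o a b → IsPT ψ → Src ψ b → ψ ≈E χ ∙ φ → Src χ b →
              IsPT (χ ∙ φ) → IsPT ((o ∙ χ) ∙ φ) → o ∙ ψ ≈E (o ∙ χ) ∙ φ
  prefix-≈E o isPTψ srcψ ψ≈χφ srcχ isPTχφ isPToχφ =
    ≈E-trans (cong-cat (≈E-refl (ConvPT.isPT o)) ψ≈χφ (IsPT-∙ o isPTψ srcψ) (IsPT-∙ o isPTχφ srcχ))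
             (assoc (IsPT-∙ o isPTχφ srcχ) isPToχφ)

  source-Src : ∀ {t} → IsTree t → Src (ms t) (source t)
  source-Src {t} it = source-NoRule it , source-SCR t

  Depth0Components : PT → Set
  Depth0Components χ = Σ ℕ λ n → Count χ n × (∀ i → i < n → Σ PT λ c → Comp χ i c × Depth c 0)

  Depth0Components-null : ∀ {s} → NoRule s → Depth0Components (ms s)
  Depth0Components-null noRule = 0 , null noRule , λ _ ()

  Depth0Components-root : ∀ {t} → OneStepAt t [] → Depth0Components (ms t)
  Depth0Components-root o = 1 , one o , λ { zero _ → _ , one o , [] , o , refl ; (suc _) (s≤s ()) }

  Depth0Components-∙ : ∀ {a b} → Depth0Components a → Depth0Components b → Depth0Components (a ∙ b)
  Depth0Components-∙ {a} {b} (m , #a , ca) (n , #b , cb) = m + n , cat #a #b , comp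
    where
    comp : ∀ i → i < m + n → Σ PT λ c → Comp (a ∙ b) i c × Depth c 0
    comp i i<m+n with i <? m
    ... | yes i<m = let (c , ci , d) = ca i i<m in c , catL #a i<m ci , d
    ... | no i≮m  =
      let m≤i = ≮⇒≥ i≮m
          (c , cj , d) = cb (i ∸ m) (+-cancelˡ-< m (i ∸ m) n (subst (_< m + n) (sym (m+[n∸m]≡n m≤i)) i<m+n))
      in c , subst (λ k → Comp (a ∙ b) k c) (m+[n∸m]≡n m≤i) (catR #a cj) , d

  NoRootRedex⇒MindGe1 : ∀ {u} → NoRootRedex u → MindGe (ms u) 1
  NoRootRedex⇒MindGe1 noRedex []      μ e = ⊥-elim (noRedex μ e)
  NoRootRedex⇒MindGe1 noRedex (_ ∷ _) μ e = s≤s z≤n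

  substLab-NoRootRedex : ∀ {n} (C : FTerm S n) σ → (∀ x → C ≢ var x) → NoRootRedex (substLab C σ)
  substLab-NoRootRedex (var x)    σ nonvar = ⊥-elim (nonvar x refl)
  substLab-NoRootRedex (app f cs) σ nonvar = λ _ ()

  source-IsPT-∙ : ∀ {t} → IsTree t → IsPT (ms (source t) ∙ ms t)
  source-IsPT-∙ it = IsPT-∙ (ConvPT-null (source-IsTree it) (source-NoRule it)) (ms it) (source-Src it)

  source-factorises : ∀ {t} → IsTree t → ms t ≈E ms (source t) ∙ ms t
  source-factorises it = ≈E-sym (src-id (source-Src it) (ms it) (source-IsPT-∙ it))

  record RootSteps (t : RTree) : Set where
    field
      steps           : PT
      mid residual    : RTree
      steps-path      : ConvPT steps (source t) mid
      steps-stepwise  : Stepwise steps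
      steps-depth0    : Depth0Components steps
      residual-IsTree : IsTree residual
      residual-src    : Src (ms residual) mid
      residual-conv   : Conv (ms residual)
      residual-mind   : MindGe (ms residual) 1
      factorises      : ms t ≈E steps ∙ ms residual

    IsPT-factorisation : IsPT (steps ∙ ms residual)
    IsPT-factorisation = IsPT-∙ steps-path (ms residual-IsTree) residual-src

  module RootRedex {t} (it : IsTree t) {μ} (root : t [] ≡ just (inj₂ μ)) where

    args : Fin (rar μ) → RTree
    args j = child t (toℕ j)

    args-IsTree : ∀ j → IsTree (args j)
    args-IsTree j = IsTree-child it root (toℕ<n j)

    redex : RTree
    redex = node (inj₂ μ) (λ j → source (args j))

    redex-oneStep : OneStepAt redex []
    redex-oneStep = IsTree-node (inj₂ μ) _ (λ j → source-IsTree (args-IsTree j)) , (μ , refl) , onlyAtRoot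
      where
      onlyAtRoot : ∀ q μ′ → redex q ≡ just (inj₂ μ′) → q ≡ []
      onlyAtRoot []      _  _ = refl
      onlyAtRoot (i ∷ q) μ′ e with i <? rar μ
      ... | yes i<a = ⊥-elim (source-NoRule (args-IsTree (fromℕ< i<a)) q μ′ e)
      ... | no _    = ⊥-elim (nothing≢just e)

    contractum : RTree
    contractum = substLab (rhs μ) (λ j → source (args j))

    contractum-NoRule : NoRule contractum
    contractum-NoRule = NoRule-substLab (rhs μ) _ (λ x _ → source-NoRule (args-IsTree x))

    redex-args : ∀ x → source (args x) ≈ₜ child redex (toℕ x)
    redex-args x q = sym (node-toℕ (inj₂ μ) _ x q)

    redex-path : ConvPT (ms redex) (source t) contractum
    redex-path = record
      { isPT = ms (proj₁ redex-oneStep)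
      ; conv = contractum , contractum-NoRule , contract
      ; src  = source-NoRule it , snoc (nil ≈ₜ-refl) [] z≤n
                 (μ , refl , λ q → trans (source-root t μ root q) (substLab-≈ (lhs μ) redex-args q))
      ; tgt  = contractum-NoRule , contract }
      where
      contract : SCR rhs 0 redex contractum
      contract = snoc (nil ≈ₜ-refl) [] z≤n (μ , refl , substLab-≈ (rhs μ) redex-args)

    rhsTree : RTree
    rhsTree = proj₁ (substPT-ms (rhs μ) args)

    rhsTree-≈ : rhsTree ≈ₜ substLab (rhs μ) args
    rhsTree-≈ = proj₂ (proj₂ (substPT-ms (rhs μ) args))

    rhsTree-IsTree : IsTree rhsTree
    rhsTree-IsTree = IsTree-≈ (IsTree-substLab (rhs μ) args args-IsTree) (≈ₜ-sym rhsTree-≈)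

    rhsTree-src : Src (ms rhsTree) contractum
    rhsTree-src = contractum-NoRule , SCR-respˡ rhsTree-≈ (SCR-substLab (rhs μ) (λ x _ → source-SCR (args x)))

    t≈redex : t ≈ₜ node (inj₂ μ) args
    t≈redex []      = root
    t≈redex (i ∷ p) with i <? rar μ
    ... | yes i<a = cong (λ k → t (k ∷ p)) (sym (toℕ-fromℕ< i<a))
    ... | no ¬i<a = IsTree-outside it root (≮⇒≥ ¬i<a) p

    -- The instance μ(ψ⃗) = μ(src ψ⃗) · r[ψ⃗] of ≈E for the multisteps ψᵢ = ms (args i).
    redex-factorises : ms t ≈E ms redex ∙ ms rhsTree
    redex-factorises = ≈E-trans (tree-eq it t≈redex)
      (subst₂ _≈E_ redexes split
        (rl-out {ψs = λ i → ms (args i)} _ (λ i → source-Src (args-IsTree i))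
          (subst IsPT (sym redexes) (ms (IsTree-node (inj₂ μ) args args-IsTree)))
          (subst IsPT (sym split) (IsPT-∙ redex-path (ms rhsTree-IsTree) rhsTree-src))))
      where
      redexes : smartRl μ (λ i → ms (args i)) ≡ ms (node (inj₂ μ) args)
      redexes = smartRl-ms μ args
      split : smartRl μ (λ i → ms (source (args i))) ∙ substPT (rhs μ) (λ i → ms (args i))
              ≡ ms redex ∙ ms rhsTree
      split = cong₂ _∙_ (smartRl-ms μ _) (proj₁ (proj₂ (substPT-ms (rhs μ) args)))

    single : Conv (ms t) → (∀ x → rhs μ ≢ var x) → RootSteps t
    single cv nonvar = record
      { steps = ms redex ; mid = contractum ; residual = rhsTree
      ; steps-path = redex-path ; steps-stepwise = one redex-oneStep
      ; steps-depth0 = Depth0Components-root redex-oneStep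
      ; residual-IsTree = rhsTree-IsTree ; residual-src = rhsTree-src
      ; residual-conv = let (s , noRule , R) = Conv-contractum root cv in s , noRule , SCR-respˡ rhsTree-≈ R
      ; residual-mind = NoRootRedex⇒MindGe1 λ μ′ e →
          substLab-NoRootRedex (rhs μ) args nonvar μ′ (trans (sym (rhsTree-≈ [])) e)
      ; factorises = redex-factorises }

    module _ {x} (collapsing : rhs μ ≡ var x) (cv : Conv (ms t)) where

      arg-conv : Conv (ms (args x))
      arg-conv = Conv-argument root cv x (subst (x occursIn_) (sym collapsing) here)

      redex-path′ : ConvPT (ms redex) (source t) (source (args x))
      redex-path′ = ConvPT-ms-tgt-≈ redex-path (λ p → cong (λ C → substLab C (λ j → source (args j)) p) collapsing)

      collapse-factorises : ms t ≈E ms redex ∙ ms (args x)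
      collapse-factorises = ≈E-trans redex-factorises
        (cong-cat (≈E-refl (ConvPT.isPT redex-path))
          (tree-eq rhsTree-IsTree (≈ₜ-trans rhsTree-≈ (λ p → cong (λ C → substLab C args p) collapsing)))
          (IsPT-∙ redex-path (ms rhsTree-IsTree) rhsTree-src)
          (IsPT-∙ redex-path′ (ms (args-IsTree x)) (source-Src (args-IsTree x))))

      collapse : NoRootRedex (args x) ⊎ RootSteps (args x) → RootSteps t
      collapse (inj₁ noRedex) = record
        { steps = ms redex ; mid = source (args x) ; residual = args x
        ; steps-path = redex-path′ ; steps-stepwise = one redex-oneStep
        ; steps-depth0 = Depth0Components-root redex-oneStep
        ; residual-IsTree = args-IsTree x ; residual-src = source-Src (args-IsTree x)
        ; residual-conv = arg-conv ; residual-mind = NoRootRedex⇒MindGe1 noRedex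
        ; factorises = collapse-factorises }
      collapse (inj₂ r) = record
        { steps = ms redex ∙ steps ; mid = mid ; residual = residual
        ; steps-path = path ; steps-stepwise = cat (one redex-oneStep) steps-stepwise (ConvPT.isPT path)
        ; steps-depth0 = Depth0Components-∙ (Depth0Components-root redex-oneStep) steps-depth0
        ; residual-IsTree = residual-IsTree ; residual-src = residual-src
        ; residual-conv = residual-conv ; residual-mind = residual-mind
        ; factorises = ≈E-trans collapse-factorises
            (prefix-≈E redex-path′ (ms (args-IsTree x)) (source-Src (args-IsTree x)) factorises
              (ConvPT.src steps-path) IsPT-factorisation (IsPT-∙ path (ms residual-IsTree) residual-src)) }
        where
        open RootSteps r
        path : ConvPT (ms redex ∙ steps) (source t) mid
        path = ConvPT-∙ redex-path′ steps-path

  rootSteps : ∀ {t} → IsTree t → Conv (ms t) → FiniteCollapse t → NoRootRedex t ⊎ RootSteps t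
  rootSteps {t} it cv (halt notCollapsing) = byRoot (t []) refl
    where
    byRoot : ∀ l → t [] ≡ l → NoRootRedex t ⊎ RootSteps t
    byRoot nothing         root = ⊥-elim (IsTree.root it root)
    byRoot (just (inj₁ f)) root = inj₁ λ μ e → fn≢rule (trans (sym root) e)
    byRoot (just (inj₂ μ)) root = inj₂ (RootRedex.single it root cv (λ x → notCollapsing μ x root))
  rootSteps it cv (next root collapsing c) =
    inj₂ (RootRedex.collapse it root collapsing cv
           (rootSteps (RootRedex.args-IsTree it root _) (RootRedex.arg-conv it root collapsing cv) c))

mainTheorem10 : (S : Signature) (T : TRS S) → let open Theory S T in
    (t : RTree) → IsTree t → Conv (ms t) →
    Σ PT λ χ → Σ PT λ φ →
      (ms t ≈E χ ∙ φ)
      × IsPT (χ ∙ φ)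
      × StepwiseOrNull χ
      × (Σ ℕ λ n → Count χ n × (∀ i → i < n → Σ PT λ c → Comp χ i c × Depth c 0))
      × (Σ RTree λ u → φ ≡ ms u × IsTree u × Conv φ × MindGe φ 1)
mainTheorem10 S T t it cv with Factorisation.rootSteps S T it cv (Factorisation.Conv⇒FiniteCollapse S T cv)
... | inj₁ noRedex =
  ms (source t) , ms t , source-factorises it , source-IsPT-∙ it ,
  inj₂ (source t , refl , source-IsTree it , source-NoRule it) , Depth0Components-null (source-NoRule it) ,
  t , refl , it , cv , NoRootRedex⇒MindGe1 noRedex
  where
  open Theory S T using (ms)
  open Factorisation S T
... | inj₂ r =
  steps , ms residual , factorises , IsPT-factorisation , inj₁ steps-stepwise , steps-depth0 ,
  residual , refl , residual-IsTree , residual-conv , residual-mind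
  where
  open Theory S T using (ms)
  open Factorisation.RootSteps r
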